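{- For every finite simple graph $G$, the set $\mathrm{diadem}(G)$ is a critical set of $G$, i.e. $d(\mathrm{diadem}(G)) = d(G)$.
   Context: For a graph $G$ and $X\subseteq V(G)$, $N(X)=\{v\in V(G): N(v)\cap X\neq\emptyset\}$ (so $N(X)$ may intersect $X$), and the difference of $X$ is $d(X)=|X|-|N(X)|$, with $d(\emptyset)=0$. The critical difference is $d(G)=\max\{d(X):X\subseteq V(G)\}$; a set $X\subseteq V(G)$ is critical if $d(X)=d(G)$. An independent set $A$ is a critical independent set if $d(A)=\max\{d(I): I \text{ independent in } G\}$ (this maximum equals $d(G)$). $\mathrm{diadem}(G)$ is the union of all critical independent sets of $G$. -}

module Defs where

open import Data.Nat using (ℕ)
open import Data.Bool using (Bool; true; false; _∧_; _∨_; T)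
open import Data.Fin using (Fin)
open import Data.Fin.Subset using (Subset; _∈_; ∣_∣)
open import Data.Vec using (Vec; []; _∷_; tabulate; lookup)
open import Data.Integer using (ℤ; _-_; _≤_; +_)
open import Data.Product using (Σ; ∃; _×_)
open import Relation.Binary.PropositionalEquality using (_≡_)
open import Relation.Nullary using (¬_)
open import Function.Bundles using (_⇔_)

record Graph (n : ℕ) : Set where
  field
    adj   : Fin n → Fin n → Bool
    sym   : ∀ u v → adj u v ≡ adj v u
    irrefl : ∀ v → adj v v ≡ false
open Graph public

anyFin : ∀ {n} → (Fin n → Bool) → Bool
anyFin {ℕ.zero}  f = false
anyFin {ℕ.suc n} f = f Fin.zero ∨ anyFin (λ i → f (Fin.suc i))

N : ∀ {n} → Graph n → Subset n → Subset n
N G X = tabulate (λ v → anyFin (λ u → adj G v u ∧ lookup X u))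

d : ∀ {n} → Graph n → Subset n → ℤ
d G X = + ∣ X ∣ - + ∣ N G X ∣

Independent : ∀ {n} → Graph n → Subset n → Set
Independent G X = ∀ u v → u ∈ X → v ∈ X → adj G u v ≡ false

-- X is critical: d(X) = d(G) = max over all subsets
Critical : ∀ {n} → Graph n → Subset n → Set
Critical G X = ∀ Y → d G Y ≤ d G X

CriticalIndependent : ∀ {n} → Graph n → Subset n → Set
CriticalIndependent G A = Independent G A × (∀ I → Independent G I → d G I ≤ d G A)

IsDiadem : ∀ {n} → Graph n → Subset n → Set
IsDiadem G D = ∀ v → (v ∈ D ⇔ Σ (Subset _) (λ A → CriticalIndependent G A × v ∈ A))

-- The difference d is supermodular, d X + d Y ≤ d (X ∪ Y) + d (X ∩ Y), because
-- N (X ∪ Y) ⊆ N X ∪ N Y and N (X ∩ Y) ⊆ N X ∩ N Y; so critical sets are closed under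
-- union. The independent set X ─ N X has difference at least d X: no vertex of X ∩ N X
-- has a neighbour in X ─ N X, so passing from X to X ─ N X removes at least as many
-- vertices from the neighbourhood as from the set. Hence every critical independent set
-- is critical, one exists (X ─ N X for a maximiser X of d), and the diadem, a finite
-- union of them, is critical.
module Submission where

open import Data.Nat as ℕ using (ℕ; zero; suc)
import Data.Nat.Properties as ℕ
open import Data.Bool using (Bool; true; false; _∧_; _∨_)
open import Data.Bool.Properties using (∨-zeroʳ; ∧-conicalˡ; ∧-conicalʳ; ¬-not)
open import Data.Fin using (Fin)
open import Data.Fin.Subset
  using (Subset; inside; outside; _∈_; _∉_; _⊆_; _∪_; _∩_; _─_; ∣_∣; Empty)
  renaming (⊥ to ∅)
open import Data.Fin.Subset.Properties
  using (_∈?_; ⊆-antisym; p⊆q⇒∣p∣≤∣q∣; ∣⊥∣≡0; Empty-unique; p⊆p∪q; q⊆p∪q;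
         x∈p∪q⁺; x∈p∪q⁻; x∈p∩q⁺; x∈p∩q⁻; p∩q⊆p; p∩q⊆q; p─q⊆p)
open import Data.Vec using ([]; _∷_; here; there)
open import Data.Vec.Properties using (lookup∘tabulate; []=⇒lookup; lookup⇒[]=)
open import Data.Integer using (ℤ; 0ℤ; +_; -_; _+_; _-_; _≤_; +≤+)
import Data.Integer.Properties as ℤ
open import Data.Integer.Tactic.RingSolver using (solve-∀)
open import Data.List using (List; []; _∷_; allFin)
open import Data.List.Membership.Propositional using () renaming (_∈_ to _∈ₗ_)
open import Data.List.Membership.Propositional.Properties using (∈-allFin)
open import Data.List.Relation.Unary.Any using (here; there)
open import Data.Product using (Σ; ∃; _×_; _,_)
open import Data.Sum as Sum using ([_,_]; inj₁; inj₂)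
open import Function using (_∘_; _⇔_; Equivalence)
open import Relation.Binary.Bundles using (TotalOrder)
open import Relation.Binary.PropositionalEquality
  using (_≡_; refl; sym; trans; cong; cong₂; subst; subst₂; module ≡-Reasoning)
open import Relation.Nullary using (yes; no; contradiction)
open import Relation.Unary using (Pred)
open import Defs renaming (sym to adj-sym)

private
  variable
    n : ℕ
    x : Fin n
    p q r : Subset n

∣p∪q∣+∣p∩q∣≡∣p∣+∣q∣ : ∀ (p q : Subset n) → ∣ p ∪ q ∣ ℕ.+ ∣ p ∩ q ∣ ≡ ∣ p ∣ ℕ.+ ∣ q ∣
∣p∪q∣+∣p∩q∣≡∣p∣+∣q∣ []            []            = refl
∣p∪q∣+∣p∩q∣≡∣p∣+∣q∣ (inside  ∷ p) (inside  ∷ q) = cong suc (begin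
  ∣ p ∪ q ∣ ℕ.+ suc ∣ p ∩ q ∣  ≡⟨ ℕ.+-suc _ _ ⟩
  suc (∣ p ∪ q ∣ ℕ.+ ∣ p ∩ q ∣) ≡⟨ cong suc (∣p∪q∣+∣p∩q∣≡∣p∣+∣q∣ p q) ⟩
  suc (∣ p ∣ ℕ.+ ∣ q ∣)        ≡⟨ ℕ.+-suc _ _ ⟨
  ∣ p ∣ ℕ.+ suc ∣ q ∣          ∎)
  where open ≡-Reasoning
∣p∪q∣+∣p∩q∣≡∣p∣+∣q∣ (inside  ∷ p) (outside ∷ q) = cong suc (∣p∪q∣+∣p∩q∣≡∣p∣+∣q∣ p q)
∣p∪q∣+∣p∩q∣≡∣p∣+∣q∣ (outside ∷ p) (inside  ∷ q) =
  trans (cong suc (∣p∪q∣+∣p∩q∣≡∣p∣+∣q∣ p q)) (sym (ℕ.+-suc _ _))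
∣p∪q∣+∣p∩q∣≡∣p∣+∣q∣ (outside ∷ p) (outside ∷ q) = ∣p∪q∣+∣p∩q∣≡∣p∣+∣q∣ p q

∣p∣≡∣p∩q∣+∣p─q∣ : ∀ (p q : Subset n) → ∣ p ∣ ≡ ∣ p ∩ q ∣ ℕ.+ ∣ p ─ q ∣
∣p∣≡∣p∩q∣+∣p─q∣ []            []            = refl
∣p∣≡∣p∩q∣+∣p─q∣ (inside  ∷ p) (inside  ∷ q) = cong suc (∣p∣≡∣p∩q∣+∣p─q∣ p q)
∣p∣≡∣p∩q∣+∣p─q∣ (inside  ∷ p) (outside ∷ q) =
  trans (cong suc (∣p∣≡∣p∩q∣+∣p─q∣ p q)) (sym (ℕ.+-suc _ _))
∣p∣≡∣p∩q∣+∣p─q∣ (outside ∷ p) (inside  ∷ q) = ∣p∣≡∣p∩q∣+∣p─q∣ p q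
∣p∣≡∣p∩q∣+∣p─q∣ (outside ∷ p) (outside ∷ q) = ∣p∣≡∣p∩q∣+∣p─q∣ p q

∪-lub : p ⊆ r → q ⊆ r → p ∪ q ⊆ r
∪-lub {p = p} {q = q} p⊆r q⊆r = [ p⊆r , q⊆r ] ∘ x∈p∪q⁻ p q

disjoint⇒∣p∣+∣q∣≤∣r∣ : {p q r : Subset n} →
                       Empty (p ∩ q) → p ⊆ r → q ⊆ r → ∣ p ∣ ℕ.+ ∣ q ∣ ℕ.≤ ∣ r ∣
disjoint⇒∣p∣+∣q∣≤∣r∣ {n} {p} {q} {r} p∩q-empty p⊆r q⊆r = begin
  ∣ p ∣ ℕ.+ ∣ q ∣          ≡⟨ ∣p∪q∣+∣p∩q∣≡∣p∣+∣q∣ p q ⟨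
  ∣ p ∪ q ∣ ℕ.+ ∣ p ∩ q ∣  ≡⟨ cong (λ (s : Subset n) → ∣ p ∪ q ∣ ℕ.+ ∣ s ∣)
                                   (Empty-unique {p = p ∩ q} p∩q-empty) ⟩
  ∣ p ∪ q ∣ ℕ.+ ∣ ∅ {n} ∣  ≡⟨ cong (∣ p ∪ q ∣ ℕ.+_) (∣⊥∣≡0 n) ⟩
  ∣ p ∪ q ∣ ℕ.+ 0          ≡⟨ ℕ.+-identityʳ _ ⟩
  ∣ p ∪ q ∣                ≤⟨ p⊆q⇒∣p∣≤∣q∣ (∪-lub p⊆r q⊆r) ⟩
  ∣ r ∣                    ∎
  where open ℕ.≤-Reasoning

x∈p─q⇒x∉q : ∀ (p q : Subset n) → x ∈ p ─ q → x ∉ q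
x∈p─q⇒x∉q (s ∷ p) (outside ∷ q) here          ()
x∈p─q⇒x∉q (s ∷ p) (t       ∷ q) (there x∈p─q) (there x∈q) = x∈p─q⇒x∉q p q x∈p─q x∈q

+-cancelʳ-≤ : ∀ i j k → i + k ≤ j + k → i ≤ j
+-cancelʳ-≤ i j k i+k≤j+k =
  subst₂ _≤_ (i+k-k≡i i k) (i+k-k≡i j k) (ℤ.+-monoˡ-≤ (- k) i+k≤j+k)
  where
  i+k-k≡i : ∀ i k → i + k - k ≡ i
  i+k-k≡i = solve-∀

minus-monoʳ-≥-≤ : ∀ i {j k} → j ≤ k → i - k ≤ i - j
minus-monoʳ-≥-≤ i j≤k = ℤ.+-monoʳ-≤ i (ℤ.neg-mono-≤ j≤k)

+[a+b]-+[c+e]≡[+a-+c]+[+b-+e] : ∀ a b c e →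
  + (a ℕ.+ b) - + (c ℕ.+ e) ≡ (+ a - + c) + (+ b - + e)
+[a+b]-+[c+e]≡[+a-+c]+[+b-+e] a b c e =
  trans (cong₂ _-_ (ℤ.pos-+ a b) (ℤ.pos-+ c e)) (regroup (+ a) (+ b) (+ c) (+ e))
  where
  regroup : ∀ i j k l → (i + j) - (k + l) ≡ (i - k) + (j - l)
  regroup = solve-∀

supermodular⇒maximisers-∪-closed : (f : Subset n → ℤ) →
  (∀ p q → f p + f q ≤ f (p ∪ q) + f (p ∩ q)) →
  (∀ Y → f Y ≤ f p) → (∀ Y → f Y ≤ f q) → ∀ Y → f Y ≤ f (p ∪ q)
supermodular⇒maximisers-∪-closed {p = p} {q = q} f supermodular p-max q-max Y =
  ℤ.≤-trans (p-max Y) (+-cancelʳ-≤ (f p) (f (p ∪ q)) (f q)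
    (ℤ.≤-trans (supermodular p q) (ℤ.+-monoʳ-≤ (f (p ∪ q)) (q-max (p ∩ q)))))

module _ {c ℓ₁ ℓ₂} (O : TotalOrder c ℓ₁ ℓ₂) where
  open TotalOrder O using (Carrier; total)
    renaming (_≤_ to _≤ₒ_; refl to ≤ₒ-refl; trans to ≤ₒ-trans)

  subset-argmax : ∀ n (f : Subset n → Carrier) → ∃ λ M → ∀ Y → f Y ≤ₒ f M
  subset-argmax zero    f = [] , λ { [] → ≤ₒ-refl }
  subset-argmax (suc n) f
    with subset-argmax n (f ∘ (outside ∷_)) | subset-argmax n (f ∘ (inside ∷_))
  ... | M₀ , max₀ | M₁ , max₁ with total (f (outside ∷ M₀)) (f (inside ∷ M₁))
  ... | inj₁ ≤M₁ = inside ∷ M₁ ,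
        λ { (outside ∷ Y) → ≤ₒ-trans (max₀ Y) ≤M₁ ; (inside ∷ Y) → max₁ Y }
  ... | inj₂ ≤M₀ = outside ∷ M₀ ,
        λ { (outside ∷ Y) → max₀ Y ; (inside ∷ Y) → ≤ₒ-trans (max₁ Y) ≤M₀ }

module _ {ℓ ℓ′} {P : Pred (Subset n) ℓ} {ℱ : Pred (Subset n) ℓ′}
         (P-∪ : ∀ {A B} → P A → P B → P (A ∪ B)) (ℱ⊆P : ∀ {A} → ℱ A → P A) where

  ∪-closed⇒⋃-closed : ∃ ℱ → ∀ {D} → (∀ v → v ∈ D ⇔ Σ (Subset n) λ A → ℱ A × v ∈ A) → P D
  ∪-closed⇒⋃-closed (A₀ , ℱA₀) {D} D≡⋃ℱ =
    let C , PC , C⊆D , covers = cover (allFin _)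
    in  subst P (⊆-antisym C⊆D (covers (∈-allFin _))) PC
    where
    ℱ⊆D : ∀ {A} → ℱ A → A ⊆ D
    ℱ⊆D ℱA v∈A = Equivalence.from (D≡⋃ℱ _) (_ , ℱA , v∈A)

    cover : (vs : List (Fin n)) →
            ∃ λ C → P C × C ⊆ D × (∀ {v} → v ∈ₗ vs → v ∈ D → v ∈ C)
    cover []       = A₀ , ℱ⊆P ℱA₀ , ℱ⊆D ℱA₀ , λ ()
    cover (w ∷ vs) with cover vs | w ∈? D
    ... | C , PC , C⊆D , covers | no w∉D =
      C , PC , C⊆D ,
      λ { (here refl) w∈D → contradiction w∈D w∉D ; (there v∈vs) → covers v∈vs }
    ... | C , PC , C⊆D , covers | yes w∈D
      with A , ℱA , w∈A ← Equivalence.to (D≡⋃ℱ w) w∈D =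
      C ∪ A , P-∪ PC (ℱ⊆P ℱA) , ∪-lub C⊆D (ℱ⊆D ℱA) ,
      λ { (here refl) _ → q⊆p∪q C A w∈A ; (there v∈vs) v∈D → p⊆p∪q A (covers v∈vs v∈D) }

anyFin⁺ : (f : Fin n → Bool) (i : Fin n) → f i ≡ true → anyFin f ≡ true
anyFin⁺ f Fin.zero    fi≡true = cong (_∨ anyFin (f ∘ Fin.suc)) fi≡true
anyFin⁺ f (Fin.suc i) fi≡true =
  trans (cong (f Fin.zero ∨_) (anyFin⁺ (f ∘ Fin.suc) i fi≡true)) (∨-zeroʳ _)

anyFin⁻ : (f : Fin n → Bool) → anyFin f ≡ true → ∃ λ i → f i ≡ true
anyFin⁻ {suc n} f any≡true with f Fin.zero in f0≡true
... | true  = Fin.zero , f0≡true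
... | false with i , fi≡true ← anyFin⁻ (f ∘ Fin.suc) any≡true = Fin.suc i , fi≡true

module _ (G : Graph n) where

  ∈N⁺ : ∀ {X v u} → adj G v u ≡ true → u ∈ X → v ∈ N G X
  ∈N⁺ {X} {v} {u} vu u∈X = lookup⇒[]= v _ (trans (lookup∘tabulate _ v)
    (anyFin⁺ _ u (cong₂ _∧_ vu ([]=⇒lookup u∈X))))

  ∈N⁻ : ∀ {X v} → v ∈ N G X → ∃ λ u → adj G v u ≡ true × u ∈ X
  ∈N⁻ {X} {v} v∈NX
    with u , vu∧u∈X ← anyFin⁻ _ (trans (sym (lookup∘tabulate _ v)) ([]=⇒lookup v∈NX)) =
    u , ∧-conicalˡ _ _ vu∧u∈X , lookup⇒[]= u X (∧-conicalʳ _ _ vu∧u∈X)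

  N-mono : p ⊆ q → N G p ⊆ N G q
  N-mono p⊆q v∈Np with u , vu , u∈p ← ∈N⁻ v∈Np = ∈N⁺ vu (p⊆q u∈p)

  N-∪ : ∀ p q → N G (p ∪ q) ⊆ N G p ∪ N G q
  N-∪ p q v∈N[p∪q] with u , vu , u∈p∪q ← ∈N⁻ v∈N[p∪q] =
    x∈p∪q⁺ (Sum.map (∈N⁺ vu) (∈N⁺ vu) (x∈p∪q⁻ p q u∈p∪q))

  N-∩ : ∀ p q → N G (p ∩ q) ⊆ N G p ∩ N G q
  N-∩ p q v∈N[p∩q] = x∈p∩q⁺ (N-mono (p∩q⊆p p q) v∈N[p∩q] , N-mono (p∩q⊆q p q) v∈N[p∩q])

  ∣N[p∪q]∣+∣N[p∩q]∣≤∣Np∣+∣Nq∣ : ∀ p q →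
    ∣ N G (p ∪ q) ∣ ℕ.+ ∣ N G (p ∩ q) ∣ ℕ.≤ ∣ N G p ∣ ℕ.+ ∣ N G q ∣
  ∣N[p∪q]∣+∣N[p∩q]∣≤∣Np∣+∣Nq∣ p q = begin
    ∣ N G (p ∪ q) ∣ ℕ.+ ∣ N G (p ∩ q) ∣       ≤⟨ ℕ.+-mono-≤ (p⊆q⇒∣p∣≤∣q∣ (N-∪ p q))
                                                             (p⊆q⇒∣p∣≤∣q∣ (N-∩ p q)) ⟩
    ∣ N G p ∪ N G q ∣ ℕ.+ ∣ N G p ∩ N G q ∣   ≡⟨ ∣p∪q∣+∣p∩q∣≡∣p∣+∣q∣ (N G p) (N G q) ⟩
    ∣ N G p ∣ ℕ.+ ∣ N G q ∣                   ∎
    where open ℕ.≤-Reasoning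

  d-supermodular : ∀ p q → d G p + d G q ≤ d G (p ∪ q) + d G (p ∩ q)
  d-supermodular p q = begin
    d G p + d G q
      ≡⟨ +[a+b]-+[c+e]≡[+a-+c]+[+b-+e] ∣ p ∣ (∣ q ∣) (∣ N G p ∣) (∣ N G q ∣) ⟨
    + (∣ p ∣ ℕ.+ ∣ q ∣) - + (∣ N G p ∣ ℕ.+ ∣ N G q ∣)
      ≤⟨ minus-monoʳ-≥-≤ (+ (∣ p ∣ ℕ.+ ∣ q ∣)) (+≤+ (∣N[p∪q]∣+∣N[p∩q]∣≤∣Np∣+∣Nq∣ p q)) ⟩
    + (∣ p ∣ ℕ.+ ∣ q ∣) - + (∣ N G (p ∪ q) ∣ ℕ.+ ∣ N G (p ∩ q) ∣)
      ≡⟨ cong (λ m → + m - + (∣ N G (p ∪ q) ∣ ℕ.+ ∣ N G (p ∩ q) ∣))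
              (∣p∪q∣+∣p∩q∣≡∣p∣+∣q∣ p q) ⟨
    + (∣ p ∪ q ∣ ℕ.+ ∣ p ∩ q ∣) - + (∣ N G (p ∪ q) ∣ ℕ.+ ∣ N G (p ∩ q) ∣)
      ≡⟨ +[a+b]-+[c+e]≡[+a-+c]+[+b-+e]
           ∣ p ∪ q ∣ (∣ p ∩ q ∣) (∣ N G (p ∪ q) ∣) (∣ N G (p ∩ q) ∣) ⟩
    d G (p ∪ q) + d G (p ∩ q)
      ∎
    where open ℤ.≤-Reasoning

  critical-∪ : Critical G p → Critical G q → Critical G (p ∪ q)
  critical-∪ {p = p} {q = q} =
    supermodular⇒maximisers-∪-closed {p = p} {q = q} (d G) d-supermodular

  indepPart : Subset n → Subset n
  indepPart X = X ─ N G X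

  indepPart-independent : ∀ X → Independent G (indepPart X)
  indepPart-independent X u v u∈indepPart v∈indepPart = ¬-not λ uv →
    x∈p─q⇒x∉q X (N G X) u∈indepPart (∈N⁺ uv (p─q⊆p X (N G X) v∈indepPart))

  X∩NX∩N[indepPart]-empty : ∀ X → Empty ((X ∩ N G X) ∩ N G (indepPart X))
  X∩NX∩N[indepPart]-empty X (v , v∈both)
    with v∈X∩NX , v∈N[indepPart] ← x∈p∩q⁻ _ _ v∈both
    with w , vw , w∈indepPart ← ∈N⁻ v∈N[indepPart] =
    x∈p─q⇒x∉q X (N G X) w∈indepPart
      (∈N⁺ (trans (adj-sym G w v) vw) (p∩q⊆p X (N G X) v∈X∩NX))

  d≤d[indepPart] : ∀ X → d G X ≤ d G (indepPart X)
  d≤d[indepPart] X = begin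
    + ∣ X ∣ - + ∣ N G X ∣
      ≡⟨ cong (λ m → + m - + ∣ N G X ∣) (∣p∣≡∣p∩q∣+∣p─q∣ X (N G X)) ⟩
    + (∣ X∩NX ∣ ℕ.+ ∣ indepPart X ∣) - + ∣ N G X ∣
      ≤⟨ minus-monoʳ-≥-≤ (+ (∣ X∩NX ∣ ℕ.+ ∣ indepPart X ∣)) (+≤+ (disjoint⇒∣p∣+∣q∣≤∣r∣
           (X∩NX∩N[indepPart]-empty X) (p∩q⊆q X (N G X)) (N-mono (p─q⊆p X (N G X))))) ⟩
    + (∣ X∩NX ∣ ℕ.+ ∣ indepPart X ∣) - + (∣ X∩NX ∣ ℕ.+ ∣ N G (indepPart X) ∣)
      ≡⟨ +[a+b]-+[c+e]≡[+a-+c]+[+b-+e]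
           ∣ X∩NX ∣ (∣ indepPart X ∣) (∣ X∩NX ∣) (∣ N G (indepPart X) ∣) ⟩
    (+ ∣ X∩NX ∣ - + ∣ X∩NX ∣) + d G (indepPart X)
      ≡⟨ cong (_+ d G (indepPart X)) (ℤ.+-inverseʳ (+ ∣ X∩NX ∣)) ⟩
    0ℤ + d G (indepPart X)
      ≡⟨ ℤ.+-identityˡ _ ⟩
    d G (indepPart X)
      ∎
    where
    open ℤ.≤-Reasoning
    X∩NX : Subset n
    X∩NX = X ∩ N G X

  criticalIndependent-exists : ∃ (CriticalIndependent G)
  criticalIndependent-exists with M , M-max ← subset-argmax ℤ.≤-totalOrder n (d G) =
    indepPart M , indepPart-independent M ,
    λ I _ → ℤ.≤-trans (M-max I) (d≤d[indepPart] M)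

  criticalIndependent⇒critical : ∀ {A} → CriticalIndependent G A → Critical G A
  criticalIndependent⇒critical (_ , A-max) Y =
    ℤ.≤-trans (d≤d[indepPart] Y) (A-max (indepPart Y) (indepPart-independent Y))

mainTheorem1 : ∀ (n : ℕ) (G : Graph n) (D : Subset n) → IsDiadem G D → Critical G D
mainTheorem1 n G D isDiadem =
  ∪-closed⇒⋃-closed {P = Critical G} (λ {A} {B} → critical-∪ G {A} {B})
    (criticalIndependent⇒critical G) (criticalIndependent-exists G) isDiadem
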